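{- If $X_1$ and $X_2$ are simplicial complexes on disjoint vertex sets $V_1$ and $V_2$, then $\theta(X_1*X_2)=\theta(X_1)+\theta(X_2)$, where $X_1*X_2=\{A\cup B: A\in X_1,\ B\in X_2\}$.
   Context: A simplicial complex $X$ on a finite set $V$ is a family of subsets of $V$ closed under taking subsets; its vertices are those $v$ with $\{v\}\in X$. For a vertex $v$, $\mathrm{del}(X;v)=\{S\in X:v\notin S\}$ and $\mathrm{lk}(X;v)=\{T\in X:v\notin T,\ T\cup\{v\}\in X\}$; $v$ is a cone vertex if $\mathrm{lk}(X;v)=\mathrm{del}(X;v)$, and $V(X)^\circ$ denotes the set of non-cone vertices. The theta-number: $\theta(X)=0$ if $V(X)^\circ=\emptyset$, and otherwise $\theta(X)=\min_{v\in V(X)^\circ}\max\{\theta(\mathrm{del}(X;v)),\theta(\mathrm{lk}(X;v))+1\}$. -}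

module Defs where

open import Data.Bool using (Bool; true; false; _∧_; not; if_then_else_)
open import Data.Nat using (ℕ; zero; suc; _+_; _⊔_; _⊓_)
open import Data.Fin using (Fin)
open import Data.Fin.Subset using (Subset; _⊆_; ⁅_⁆; outside; inside) renaming (⊥ to ∅)
open import Data.List using (List; []; _∷_; foldr; map; filter; allFin) renaming (_++_ to _++ˡ_)
open import Data.Vec using (Vec; []; _∷_; lookup; _[_]≔_; take; drop)
open import Relation.Binary.PropositionalEquality using (_≡_)

Family : ℕ → Set
Family n = Subset n → Bool

IsSimplicialComplex : {n : ℕ} → Family n → Set
IsSimplicialComplex {n} X = (A B : Subset n) → A ⊆ B → X B ≡ true → X A ≡ true

allSubsets : (n : ℕ) → List (Subset n)
allSubsets zero    = [] ∷ []
allSubsets (suc n) = map (outside ∷_) (allSubsets n) ++ˡ map (inside ∷_) (allSubsets n)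

sameFamily : {n : ℕ} → Family n → Family n → Bool
sameFamily {n} X Y = allL (allSubsets n)
  where
  eqB : Bool → Bool → Bool
  eqB true  b = b
  eqB false b = not b
  allL : List (Subset n) → Bool
  allL [] = true
  allL (S ∷ Ss) = eqB (X S) (Y S) ∧ allL Ss

del : {n : ℕ} → Family n → Fin n → Family n
del X v S = not (lookup S v) ∧ X S

lk : {n : ℕ} → Family n → Fin n → Family n
lk X v T = not (lookup T v) ∧ (X T ∧ X (T [ v ]≔ inside))

isVertex : {n : ℕ} → Family n → Fin n → Bool
isVertex X v = X ⁅ v ⁆

-- v ∈ V(X)°: v is a vertex and not a cone vertex
isNonConeVertex : {n : ℕ} → Family n → Fin n → Bool
isNonConeVertex X v = isVertex X v ∧ not (sameFamily (lk X v) (del X v))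

-- minimum of a list (0 on the empty list; only used when the list is empty
-- exactly in the case θ = 0)
minList : List ℕ → ℕ
minList []       = 0
minList (x ∷ xs) = foldr _⊓_ x xs

-- θ with fuel: each recursive call removes a vertex (v is not a vertex of
-- del(X;v) nor of lk(X;v)), and there are at most n vertices, so fuel n
-- is always enough and θ-fuel n X is the θ-number of X.
θ-fuel : {n : ℕ} → ℕ → Family n → ℕ
θ-fuel zero    X = 0
θ-fuel {n} (suc k) X =
  minList (map (λ v → θ-fuel k (del X v) ⊔ suc (θ-fuel k (lk X v)))
               (filter′ (allFin n)))
  where
  filter′ : List (Fin n) → List (Fin n)
  filter′ []       = []
  filter′ (v ∷ vs) = if isNonConeVertex X v then v ∷ filter′ vs else filter′ vs

θ : {n : ℕ} → Family n → ℕ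
θ {n} X = θ-fuel n X

-- Join of X₁ on Fin m and X₂ on Fin k, on the disjoint union Fin (m + k)
-- (first m coordinates = V₁, last k coordinates = V₂):
-- S ∈ X₁ * X₂ iff S ∩ V₁ ∈ X₁ and S ∩ V₂ ∈ X₂, i.e. S = A ∪ B with A ∈ X₁, B ∈ X₂.
join : {m k : ℕ} → Family m → Family k → Family (m + k)
join {m} X₁ X₂ S = X₁ (take m S) ∧ X₂ (drop m S)

{-# OPTIONS --safe #-}
module Submission where

-- A vertex of X₁ * X₂ is a vertex of X₁ or of X₂. For a vertex v of X₁, deleting or linking v
-- in the join gives the join of del(X₁;v) or lk(X₁;v) with X₂, and since ∅ ∈ X₂, v is a cone
-- vertex of the join iff it is one of X₁ (symmetrically for X₂). Hence the recursion defining
-- θ(X₁ * X₂) is the recursion for X₁ shifted by θ(X₂) together with the recursion for X₂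
-- shifted by θ(X₁); since adding a constant commutes with max and min, induction gives
-- θ(X₁ * X₂) = min(θ(X₁) + θ(X₂), θ(X₁) + θ(X₂)). Formally θ is computed with fuel, and the
-- induction is on the fuel, keeping the invariant that the fuel bounds the number of vertices.

open import Defs
open import Algebra.Properties.CommutativeSemigroup using (x∙yz≈y∙xz)
import Algebra.Solver.IdempotentCommutativeMonoid as ICM-Solver
open import Data.Bool using (Bool; true; false; _∧_; not; if_then_else_; T)
open import Data.Bool.Properties using (_≟_; ∧-assoc; ∧-identityʳ; ∧-idempotentCommutativeMonoid; ⇔→≡; T-≡)
open import Data.Fin using (Fin; zero; suc; _↑ˡ_; _↑ʳ_)
open import Data.Fin.Subset using (Subset; ⁅_⁆; inside; outside; _⊂_; ∣_∣) renaming (⊥ to ∅; _∈_ to _∈ₛ_)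
open import Data.Fin.Subset.Properties using (x∈⁅x⁆; ∉⊥; ⊥⊆; ∣⊥∣≡0; ∣p∣≤n; p⊂q⇒∣p∣<∣q∣)
open import Data.List using (List; []; _∷_; _++_; map; foldr; filterᵇ; allFin; tabulate)
open import Data.List.Membership.Propositional using (_∈_)
open import Data.List.Membership.Propositional.Properties using (∈-map⁺; ∈-++⁺ˡ; ∈-++⁺ʳ; ∈-filter⁻)
open import Data.List.Properties
  using (map-++; map-∘; map-cong; map-cong-local; map-tabulate; foldr-map; foldr-fusion; foldr-++; ++-identityʳ; filter-++; filter-≐; filter-none)
open import Data.List.Relation.Unary.All as All using (all?)
open import Data.List.Relation.Unary.Any using (here)
open import Data.Nat using (ℕ; zero; suc; pred; _+_; _⊔_; _⊓_; _≤_; _<_; s≤s)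
open import Data.Nat.Properties
  using (+-suc; +-distribˡ-⊔; +-distribʳ-⊔; +-distribˡ-⊓; +-distribʳ-⊓; ⊓-comm; ⊓-idem; ⊓-commutativeSemigroup; <-≤-trans; <⇒≤pred; suc-injective)
open import Data.Product using (_×_; _,_; proj₂)
open import Data.Vec using (Vec; _∷_; lookup; _[_]≔_; take; drop) renaming (_++_ to _++ᵥ_)
import Data.Vec as Vec
open import Data.Vec.Properties
  using (take++drop≡id; ++-injective; lookup-++ˡ; lookup-++ʳ; []≔-++-↑ˡ; []≔-++-↑ʳ; lookup∘tabulate; lookup⇒[]=; []=⇒lookup; lookup-replicate)
open import Function using (_∘_; _⇔_; mk⇔; Equivalence)
open import Function.Construct.Composition using (_⇔-∘_)
open import Function.Construct.Symmetry using (⇔-sym)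
open import Relation.Nullary using (does; proof; contradiction; ¬_)
open import Relation.Nullary.Reflects using (Reflects; invert)
open import Relation.Nullary.Decidable using (T?; dec-true)
open import Relation.Binary.PropositionalEquality using (_≡_; refl; sym; trans; cong; cong₂; subst; _≗_; module ≡-Reasoning)
open ≡-Reasoning

open ICM-Solver ∧-idempotentCommutativeMonoid using (solve; _⊕_; _⊜_)

private variable
  m k n : ℕ

∧-trueˡ : ∀ {a b} → a ∧ b ≡ true → a ≡ true
∧-trueˡ {true}  _  = refl
∧-trueˡ {false} ()

∧-trueʳ : ∀ a {b} → a ∧ b ≡ true → b ≡ true
∧-trueʳ true e = e

∧-exchange : ∀ s a b → s ∧ (a ∧ b) ≡ a ∧ (s ∧ b)
∧-exchange = solve 3 (λ s a b → s ⊕ (a ⊕ b) ⊜ a ⊕ (s ⊕ b)) refl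

∧-factorʳ : ∀ s a c b → s ∧ ((a ∧ b) ∧ (c ∧ b)) ≡ (s ∧ (a ∧ c)) ∧ b
∧-factorʳ = solve 4 (λ s a c b → s ⊕ ((a ⊕ b) ⊕ (c ⊕ b)) ⊜ (s ⊕ (a ⊕ c)) ⊕ b) refl

∧-factorˡ : ∀ s a b c → s ∧ ((a ∧ b) ∧ (a ∧ c)) ≡ a ∧ (s ∧ (b ∧ c))
∧-factorˡ = solve 4 (λ s a b c → s ⊕ ((a ⊕ b) ⊕ (a ⊕ c)) ⊜ a ⊕ (s ⊕ (b ⊕ c))) refl

if-filterᵇ : {A : Set} (p : A → Bool) (x : A) {l xs : List A} →
             l ≡ filterᵇ p xs → (if p x then x ∷ l else l) ≡ filterᵇ p (x ∷ xs)
if-filterᵇ p x refl with p x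
... | true  = refl
... | false = refl

filterᵇ-cong : {A : Set} {p q : A → Bool} → p ≗ q → filterᵇ p ≗ filterᵇ q
filterᵇ-cong p≗q = filter-≐ (T? ∘ _) (T? ∘ _) ((λ {x} → subst T (p≗q x)) , (λ {x} → subst T (sym (p≗q x))))

filterᵇ-map : {A B : Set} (p : B → Bool) (f : A → B) (xs : List A) →
              filterᵇ p (map f xs) ≡ map f (filterᵇ (p ∘ f) xs)
filterᵇ-map p f []       = refl
filterᵇ-map p f (x ∷ xs) with p (f x)
... | true  = cong (f x ∷_) (filterᵇ-map p f xs)
... | false = filterᵇ-map p f xs

tabulate-+ : {A : Set} (m : ℕ) {k : ℕ} (f : Fin (m + k) → A) → tabulate f ≡ tabulate (f ∘ (_↑ˡ k)) ++ tabulate (f ∘ (m ↑ʳ_))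
tabulate-+ zero    f = refl
tabulate-+ (suc m) f = cong (f zero ∷_) (tabulate-+ m (f ∘ suc))

allFin-+ : (m k : ℕ) → allFin (m + k) ≡ map (_↑ˡ k) (allFin m) ++ map (m ↑ʳ_) (allFin k)
allFin-+ m k = trans (tabulate-+ m (λ i → i)) (sym (cong₂ _++_ (map-tabulate (λ i → i) (_↑ˡ k)) (map-tabulate (λ i → i) (m ↑ʳ_))))

map-map-cong-local : {A B B′ C : Set} {f : A → B} {f′ : A → B′} {g : B → C} {g′ : B′ → C} {xs : List A} →
                     (∀ {x} → x ∈ xs → g (f x) ≡ g′ (f′ x)) → map g (map f xs) ≡ map g′ (map f′ xs)
map-map-cong-local {xs = xs} eq = trans (sym (map-∘ xs)) (trans (map-cong-local (All.tabulate eq)) (map-∘ xs))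

⊓-foldr : ∀ x y ys → x ⊓ foldr _⊓_ y ys ≡ foldr _⊓_ (x ⊓ y) ys
⊓-foldr x y = foldr-fusion (x ⊓_) {_⊓_} {_⊓_} y (x∙yz≈y∙xz ⊓-commutativeSemigroup x)

minList-++ : ∀ x xs y ys → minList ((x ∷ xs) ++ (y ∷ ys)) ≡ minList (x ∷ xs) ⊓ minList (y ∷ ys)
minList-++ x xs y ys = begin
  foldr _⊓_ x (xs ++ y ∷ ys)                ≡⟨ foldr-++ _⊓_ x xs (y ∷ ys) ⟩
  foldr _⊓_ (y ⊓ foldr _⊓_ x ys) xs         ≡⟨ cong (λ s → foldr _⊓_ s xs) swap-seeds ⟩
  foldr _⊓_ (foldr _⊓_ y ys ⊓ x) xs         ≡⟨ sym (⊓-foldr _ x xs) ⟩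
  foldr _⊓_ y ys ⊓ foldr _⊓_ x xs           ≡⟨ ⊓-comm _ _ ⟩
  foldr _⊓_ x xs ⊓ foldr _⊓_ y ys           ∎
  where
  swap-seeds : y ⊓ foldr _⊓_ x ys ≡ foldr _⊓_ y ys ⊓ x
  swap-seeds = begin
    y ⊓ foldr _⊓_ x ys    ≡⟨ ⊓-foldr y x ys ⟩
    foldr _⊓_ (y ⊓ x) ys  ≡⟨ cong (λ s → foldr _⊓_ s ys) (⊓-comm y x) ⟩
    foldr _⊓_ (x ⊓ y) ys  ≡⟨ sym (⊓-foldr x y ys) ⟩
    x ⊓ foldr _⊓_ y ys    ≡⟨ ⊓-comm x _ ⟩
    foldr _⊓_ y ys ⊓ x    ∎

minList-map : (h : ℕ → ℕ) → (∀ a b → h (a ⊓ b) ≡ h a ⊓ h b) →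
              ∀ x xs → minList (map h (x ∷ xs)) ≡ h (minList (x ∷ xs))
minList-map h h-⊓ x xs = trans (foldr-map _⊓_ h (h x) xs) (sym (foldr-fusion h x h-⊓ xs))

minList-+-++ : ∀ {a b} xs ys → a ≡ minList xs → b ≡ minList ys →
               minList (map (_+ b) xs ++ map (a +_) ys) ≡ a + b
minList-+-++ []       []       refl refl = refl
minList-+-++ []       (y ∷ ys) refl refl = minList-map (0 +_) (+-distribˡ-⊓ 0) y ys
minList-+-++ (x ∷ xs) []       refl refl = trans (cong minList (++-identityʳ (map (_+ 0) (x ∷ xs)))) (minList-map (_+ 0) (+-distribʳ-⊓ 0) x xs)
minList-+-++ {a} {b} (x ∷ xs) (y ∷ ys) refl refl = begin
  minList (map (_+ b) (x ∷ xs) ++ map (a +_) (y ∷ ys))          ≡⟨ minList-++ (x + b) (map (_+ b) xs) (a + y) (map (a +_) ys) ⟩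
  minList (map (_+ b) (x ∷ xs)) ⊓ minList (map (a +_) (y ∷ ys)) ≡⟨ cong₂ _⊓_ (minList-map (_+ b) (+-distribʳ-⊓ b) x xs)
                                                                             (minList-map (a +_) (+-distribˡ-⊓ a) y ys) ⟩
  (a + b) ⊓ (a + b)                                              ≡⟨ ⊓-idem _ ⟩
  a + b                                                          ∎

lookup-⁅⁆ : (v : Fin n) → lookup ⁅ v ⁆ v ≡ true
lookup-⁅⁆ v = []=⇒lookup (x∈⁅x⁆ v)

∅[]≔inside : (v : Fin n) → ∅ [ v ]≔ inside ≡ ⁅ v ⁆
∅[]≔inside zero    = refl
∅[]≔inside (suc v) = cong (outside ∷_) (∅[]≔inside v)

∈⇒∣p∣>0 : {p : Subset n} {v : Fin n} → v ∈ₛ p → 0 < ∣ p ∣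
∈⇒∣p∣>0 {n} {p} v∈p = subst (_< ∣ p ∣) (∣⊥∣≡0 n) (p⊂q⇒∣p∣<∣q∣ (⊥⊆ , _ , v∈p , ∉⊥))

p⊂q⇒∣p∣≤pred : {p q : Subset n} {f : ℕ} → p ⊂ q → ∣ q ∣ ≤ f → ∣ p ∣ ≤ pred f
p⊂q⇒∣p∣≤pred p⊂q ∣q∣≤f = <⇒≤pred (<-≤-trans (p⊂q⇒∣p∣<∣q∣ p⊂q) ∣q∣≤f)

take-drop-++ : {A : Set} (S₁ : Vec A m) (S₂ : Vec A k) →
               take m (S₁ ++ᵥ S₂) ≡ S₁ × drop m (S₁ ++ᵥ S₂) ≡ S₂
take-drop-++ {m = m} S₁ S₂ = ++-injective (take m (S₁ ++ᵥ S₂)) S₁ (take++drop≡id m (S₁ ++ᵥ S₂))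

split-ind : (P : Subset (m + k) → Set) → (∀ S₁ S₂ → P (S₁ ++ᵥ S₂)) → ∀ S → P S
split-ind {m} P h S = subst P (take++drop≡id m S) (h (take m S) (drop m S))

∅-++ : (m k : ℕ) → ∅ {m + k} ≡ ∅ {m} ++ᵥ ∅ {k}
∅-++ zero    k = refl
∅-++ (suc m) k = cong (outside ∷_) (∅-++ m k)

⁅↑ˡ⁆ : (k : ℕ) (v : Fin m) → ⁅ v ↑ˡ k ⁆ ≡ ⁅ v ⁆ ++ᵥ ∅ {k}
⁅↑ˡ⁆ {suc m} k zero    = cong (inside ∷_) (∅-++ m k)
⁅↑ˡ⁆         k (suc v) = cong (outside ∷_) (⁅↑ˡ⁆ k v)

⁅↑ʳ⁆ : (m : ℕ) (w : Fin k) → ⁅ m ↑ʳ w ⁆ ≡ ∅ {m} ++ᵥ ⁅ w ⁆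
⁅↑ʳ⁆ zero    w = refl
⁅↑ʳ⁆ (suc m) w = cong (outside ∷_) (⁅↑ʳ⁆ m w)

-- `sameFamily` and `θ-fuel` are defined through helpers local to their definitions, which
-- cannot be named here. Abstracting (with `with`) the eliminators before the list they run
-- over lets unification infer their motives from the goal; the motive of `Bool-ind₂` is fixed
-- by its use at the variables a, b, which needs `_∧_` abstracted too so that the unification
-- problem is rigid.
private
  List-ind : {A : Set} (P : List A → Set) → P [] → (∀ x {xs} → P xs → P (x ∷ xs)) → ∀ xs → P xs
  List-ind P base step []       = base
  List-ind P base step (x ∷ xs) = step x (List-ind P base step xs)

  Bool-ind₂ : (P : Bool → Bool → Set) →
              P true true → P true false → P false true → P false false → ∀ a b → P a b
  Bool-ind₂ P tt tf ft ff true  true  = tt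
  Bool-ind₂ P tt tf ft ff true  false = tf
  Bool-ind₂ P tt tf ft ff false true  = ft
  Bool-ind₂ P tt tf ft ff false false = ff

sameFamily≡all? : (X Y : Family n) → sameFamily X Y ≡ does (all? (λ S → X S ≟ Y S) (allSubsets n))
sameFamily≡all? {n} X Y with Bool-ind₂ _ refl refl refl refl | List-ind {A = Subset n} _ refl | allSubsets n
... | _      | _         | []     = refl
... | agrees | induction | S ∷ Ss with X S | Y S | _∧_
...   | a | b | _&_ = cong₂ _&_ (agrees a b) (induction (λ S′ → cong₂ _∧_ (agrees (X S′) (Y S′))) Ss)

∈-allSubsets : (S : Subset n) → S ∈ allSubsets n
∈-allSubsets Vec.[]            = here refl
∈-allSubsets (false ∷ S)       = ∈-++⁺ˡ (∈-map⁺ (outside ∷_) (∈-allSubsets S))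
∈-allSubsets {suc n} (true ∷ S) = ∈-++⁺ʳ (map (outside ∷_) (allSubsets n)) (∈-map⁺ (inside ∷_) (∈-allSubsets S))

sameFamily⇔≗ : {X Y : Family n} → sameFamily X Y ≡ true ⇔ X ≗ Y
sameFamily⇔≗ {n} {X} {Y} = mk⇔
  (λ same S → All.lookup (invert (subst (Reflects _) (trans (sym (sameFamily≡all? X Y)) same) (proof (all? _ _)))) (∈-allSubsets S))
  (λ X≗Y → trans (sameFamily≡all? X Y) (dec-true (all? _ _) (All.universal X≗Y (allSubsets n))))

sameFamily-resp-⇔ : {A B : Family n} {C D : Family m} → (A ≗ B ⇔ C ≗ D) → sameFamily A B ≡ sameFamily C D
sameFamily-resp-⇔ A≗B⇔C≗D = ⇔→≡ (⇔-sym sameFamily⇔≗ ⇔-∘ (A≗B⇔C≗D ⇔-∘ sameFamily⇔≗))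

sameFamily-cong : {A B C D : Family n} → A ≗ C → B ≗ D → sameFamily A B ≡ sameFamily C D
sameFamily-cong A≗C B≗D = sameFamily-resp-⇔ (mk⇔
  (λ A≗B S → trans (sym (A≗C S)) (trans (A≗B S) (B≗D S)))
  (λ C≗D S → trans (A≗C S) (trans (C≗D S) (sym (B≗D S)))))

branch : ℕ → Family n → Fin n → ℕ
branch f X v = θ-fuel f (del X v) ⊔ suc (θ-fuel f (lk X v))

nonConeVertices : Family n → List (Fin n)
nonConeVertices {n} X = filterᵇ (isNonConeVertex X) (allFin n)

-- Reaches the helper filtering the non-cone vertices as in `sameFamily≡all?`; `minList` and
-- `map (branch f X)` are abstracted only to keep the unification rigid.
θ-fuel-suc : ∀ f (X : Family n) → θ-fuel (suc f) X ≡ minList (map (branch f X) (nonConeVertices X))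
θ-fuel-suc {n} f X with List-ind {A = Fin n} _ refl | minList | map (branch f X) | allFin n
... | induction | min | map-branch | vs =
  cong (min ∘ map-branch) (induction (λ v → if-filterᵇ (isNonConeVertex X) v) vs)

del-cong : {X Y : Family n} (v : Fin n) → X ≗ Y → del X v ≗ del Y v
del-cong v X≗Y S = cong (not (lookup S v) ∧_) (X≗Y S)

lk-cong : {X Y : Family n} (v : Fin n) → X ≗ Y → lk X v ≗ lk Y v
lk-cong v X≗Y S = cong (not (lookup S v) ∧_) (cong₂ _∧_ (X≗Y S) (X≗Y (S [ v ]≔ inside)))

isNonConeVertex-cong : {X Y : Family n} → X ≗ Y → isNonConeVertex X ≗ isNonConeVertex Y
isNonConeVertex-cong X≗Y v =
  cong₂ _∧_ (X≗Y ⁅ v ⁆) (cong not (sameFamily-cong (lk-cong v X≗Y) (del-cong v X≗Y)))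

θ-fuel-cong : ∀ f {X Y : Family n} → X ≗ Y → θ-fuel f X ≡ θ-fuel f Y
θ-fuel-cong zero    X≗Y = refl
θ-fuel-cong {n} (suc f) {X} {Y} X≗Y = begin
  θ-fuel (suc f) X                                ≡⟨ θ-fuel-suc f X ⟩
  minList (map (branch f X) (nonConeVertices X))  ≡⟨ cong minList (map-cong branch≗ (nonConeVertices X)) ⟩
  minList (map (branch f Y) (nonConeVertices X))  ≡⟨ cong (minList ∘ map (branch f Y)) (filterᵇ-cong (isNonConeVertex-cong X≗Y) (allFin n)) ⟩
  minList (map (branch f Y) (nonConeVertices Y))  ≡⟨ sym (θ-fuel-suc f Y) ⟩
  θ-fuel (suc f) Y                                ∎
  where
  branch≗ : branch f X ≗ branch f Y
  branch≗ v = cong₂ (λ a b → a ⊔ suc b) (θ-fuel-cong f (del-cong v X≗Y)) (θ-fuel-cong f (lk-cong v X≗Y))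

vertices : Family n → Subset n
vertices X = Vec.tabulate (isVertex X)

∈-vertices⁺ : {X : Family n} {v : Fin n} → isVertex X v ≡ true → v ∈ₛ vertices X
∈-vertices⁺ {X = X} {v} vX = lookup⇒[]= v (vertices X) (trans (lookup∘tabulate (isVertex X) v) vX)

∈-vertices⁻ : {X : Family n} {v : Fin n} → v ∈ₛ vertices X → isVertex X v ≡ true
∈-vertices⁻ {X = X} {v} v∈ = trans (sym (lookup∘tabulate (isVertex X) v)) ([]=⇒lookup v∈)

vertices-⊂ : {X Y : Family n} {v : Fin n} → (∀ {u} → isVertex Y u ≡ true → isVertex X u ≡ true) →
             isVertex X v ≡ true → isVertex Y v ≡ false → vertices Y ⊂ vertices X
vertices-⊂ {X = X} {Y} Y⊆X vX ¬vY =
  ∈-vertices⁺ {X = X} ∘ Y⊆X ∘ ∈-vertices⁻ {X = Y} , _ , ∈-vertices⁺ {X = X} vX ,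
  λ v∈ → contradiction (trans (sym (∈-vertices⁻ {X = Y} v∈)) ¬vY) λ ()

del-vertices-⊂ : (X : Family n) (v : Fin n) → isVertex X v ≡ true → vertices (del X v) ⊂ vertices X
del-vertices-⊂ X v vX =
  vertices-⊂ {X = X} {del X v} (λ {u} → ∧-trueʳ (not (lookup ⁅ u ⁆ v))) vX (cong (λ b → not b ∧ X ⁅ v ⁆) (lookup-⁅⁆ v))

lk-vertices-⊂ : (X : Family n) (v : Fin n) → isVertex X v ≡ true → vertices (lk X v) ⊂ vertices X
lk-vertices-⊂ X v vX =
  vertices-⊂ {X = X} {lk X v} (λ {u} → ∧-trueˡ ∘ ∧-trueʳ (not (lookup ⁅ u ⁆ v))) vX
             (cong (λ b → not b ∧ (X ⁅ v ⁆ ∧ X (⁅ v ⁆ [ v ]≔ inside))) (lookup-⁅⁆ v))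

∈-nonConeVertices⇒vertex : (X : Family n) {v : Fin n} → v ∈ nonConeVertices X → isVertex X v ≡ true
∈-nonConeVertices⇒vertex {n} X v∈ =
  ∧-trueˡ (Equivalence.to T-≡ (proj₂ (∈-filter⁻ (T? ∘ isNonConeVertex X) {xs = allFin n} v∈)))

nonConeVertex⇒fuel-suc : (X : Family n) {v : Fin n} {f : ℕ} →
                         v ∈ nonConeVertices X → ∣ vertices X ∣ ≤ f → f ≡ suc (pred f)
nonConeVertex⇒fuel-suc X v∈ fuel with <-≤-trans (∈⇒∣p∣>0 (∈-vertices⁺ {X = X} (∈-nonConeVertices⇒vertex X v∈))) fuel
... | s≤s _ = refl

θ-fuel-unfold : ∀ f (X : Family n) → ∣ vertices X ∣ ≤ f →
                θ-fuel f X ≡ minList (map (branch (pred f) X) (nonConeVertices X))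
θ-fuel-unfold (suc f) X _    = θ-fuel-suc f X
θ-fuel-unfold {n} zero X fuel =
  cong (minList ∘ map (branch 0 X)) (sym (filter-none (T? ∘ isNonConeVertex X) (All.universal noneLeft (allFin n))))
  where
  noneLeft : ∀ v → ¬ T (isNonConeVertex X v)
  noneLeft v t = contradiction (<-≤-trans (∈⇒∣p∣>0 (∈-vertices⁺ {X = X} (∧-trueˡ (Equivalence.to T-≡ t)))) fuel) λ ()

del-∅ : (X : Family n) (v : Fin n) → X ∅ ≡ true → del X v ∅ ≡ true
del-∅ X v ∅∈X = cong₂ (λ b c → not b ∧ c) (lookup-replicate v outside) ∅∈X

lk-∅ : (X : Family n) (v : Fin n) → X ∅ ≡ true → isVertex X v ≡ true → lk X v ∅ ≡ true
lk-∅ X v ∅∈X vX =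
  cong₂ (λ b c → not b ∧ c) (lookup-replicate v outside) (cong₂ _∧_ ∅∈X (trans (cong X (∅[]≔inside v)) vX))

join-++ : (X₁ : Family m) (X₂ : Family k) (S₁ : Subset m) (S₂ : Subset k) → join X₁ X₂ (S₁ ++ᵥ S₂) ≡ X₁ S₁ ∧ X₂ S₂
join-++ X₁ X₂ S₁ S₂ with take-drop-++ S₁ S₂
... | take≡ , drop≡ = cong₂ (λ A B → X₁ A ∧ X₂ B) take≡ drop≡

module _ (X₁ : Family m) (X₂ : Family k) where

  join-++-∅ʳ : X₂ ∅ ≡ true → ∀ S → join X₁ X₂ (S ++ᵥ ∅) ≡ X₁ S
  join-++-∅ʳ ∅∈X₂ S = trans (join-++ X₁ X₂ S ∅) (trans (cong (X₁ S ∧_) ∅∈X₂) (∧-identityʳ _))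

  join-∅-++ˡ : X₁ ∅ ≡ true → ∀ S → join X₁ X₂ (∅ ++ᵥ S) ≡ X₂ S
  join-∅-++ˡ ∅∈X₁ S = trans (join-++ X₁ X₂ ∅ S) (cong (_∧ X₂ S) ∅∈X₁)

  del-join-↑ˡ : (v : Fin m) → del (join X₁ X₂) (v ↑ˡ k) ≗ join (del X₁ v) X₂
  del-join-↑ˡ v = split-ind _ λ S₁ S₂ → begin
    not (lookup (S₁ ++ᵥ S₂) (v ↑ˡ k)) ∧ join X₁ X₂ (S₁ ++ᵥ S₂)
      ≡⟨ cong₂ (λ s j → not s ∧ j) (lookup-++ˡ S₁ S₂ v) (join-++ X₁ X₂ S₁ S₂) ⟩
    not (lookup S₁ v) ∧ (X₁ S₁ ∧ X₂ S₂)
      ≡⟨ sym (∧-assoc (not (lookup S₁ v)) (X₁ S₁) (X₂ S₂)) ⟩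
    (not (lookup S₁ v) ∧ X₁ S₁) ∧ X₂ S₂
      ≡⟨ sym (join-++ (del X₁ v) X₂ S₁ S₂) ⟩
    join (del X₁ v) X₂ (S₁ ++ᵥ S₂) ∎

  lk-join-↑ˡ : (v : Fin m) → lk (join X₁ X₂) (v ↑ˡ k) ≗ join (lk X₁ v) X₂
  lk-join-↑ˡ v = split-ind _ λ S₁ S₂ → begin
    not (lookup (S₁ ++ᵥ S₂) (v ↑ˡ k)) ∧ (join X₁ X₂ (S₁ ++ᵥ S₂) ∧ join X₁ X₂ ((S₁ ++ᵥ S₂) [ v ↑ˡ k ]≔ inside))
      ≡⟨ cong₂ (λ s j → not s ∧ (join X₁ X₂ (S₁ ++ᵥ S₂) ∧ j)) (lookup-++ˡ S₁ S₂ v) (cong (join X₁ X₂) ([]≔-++-↑ˡ S₁ S₂ v)) ⟩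
    not (lookup S₁ v) ∧ (join X₁ X₂ (S₁ ++ᵥ S₂) ∧ join X₁ X₂ ((S₁ [ v ]≔ inside) ++ᵥ S₂))
      ≡⟨ cong₂ (λ j j′ → not (lookup S₁ v) ∧ (j ∧ j′)) (join-++ X₁ X₂ S₁ S₂) (join-++ X₁ X₂ (S₁ [ v ]≔ inside) S₂) ⟩
    not (lookup S₁ v) ∧ ((X₁ S₁ ∧ X₂ S₂) ∧ (X₁ (S₁ [ v ]≔ inside) ∧ X₂ S₂))
      ≡⟨ ∧-factorʳ (not (lookup S₁ v)) (X₁ S₁) (X₁ (S₁ [ v ]≔ inside)) (X₂ S₂) ⟩
    (not (lookup S₁ v) ∧ (X₁ S₁ ∧ X₁ (S₁ [ v ]≔ inside))) ∧ X₂ S₂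
      ≡⟨ sym (join-++ (lk X₁ v) X₂ S₁ S₂) ⟩
    join (lk X₁ v) X₂ (S₁ ++ᵥ S₂) ∎

  del-join-↑ʳ : (w : Fin k) → del (join X₁ X₂) (m ↑ʳ w) ≗ join X₁ (del X₂ w)
  del-join-↑ʳ w = split-ind _ λ S₁ S₂ → begin
    not (lookup (S₁ ++ᵥ S₂) (m ↑ʳ w)) ∧ join X₁ X₂ (S₁ ++ᵥ S₂)
      ≡⟨ cong₂ (λ s j → not s ∧ j) (lookup-++ʳ S₁ S₂ w) (join-++ X₁ X₂ S₁ S₂) ⟩
    not (lookup S₂ w) ∧ (X₁ S₁ ∧ X₂ S₂)
      ≡⟨ ∧-exchange (not (lookup S₂ w)) (X₁ S₁) (X₂ S₂) ⟩
    X₁ S₁ ∧ (not (lookup S₂ w) ∧ X₂ S₂)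
      ≡⟨ sym (join-++ X₁ (del X₂ w) S₁ S₂) ⟩
    join X₁ (del X₂ w) (S₁ ++ᵥ S₂) ∎

  lk-join-↑ʳ : (w : Fin k) → lk (join X₁ X₂) (m ↑ʳ w) ≗ join X₁ (lk X₂ w)
  lk-join-↑ʳ w = split-ind _ λ S₁ S₂ → begin
    not (lookup (S₁ ++ᵥ S₂) (m ↑ʳ w)) ∧ (join X₁ X₂ (S₁ ++ᵥ S₂) ∧ join X₁ X₂ ((S₁ ++ᵥ S₂) [ m ↑ʳ w ]≔ inside))
      ≡⟨ cong₂ (λ s j → not s ∧ (join X₁ X₂ (S₁ ++ᵥ S₂) ∧ j)) (lookup-++ʳ S₁ S₂ w) (cong (join X₁ X₂) ([]≔-++-↑ʳ S₁ S₂ w)) ⟩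
    not (lookup S₂ w) ∧ (join X₁ X₂ (S₁ ++ᵥ S₂) ∧ join X₁ X₂ (S₁ ++ᵥ (S₂ [ w ]≔ inside)))
      ≡⟨ cong₂ (λ j j′ → not (lookup S₂ w) ∧ (j ∧ j′)) (join-++ X₁ X₂ S₁ S₂) (join-++ X₁ X₂ S₁ (S₂ [ w ]≔ inside)) ⟩
    not (lookup S₂ w) ∧ ((X₁ S₁ ∧ X₂ S₂) ∧ (X₁ S₁ ∧ X₂ (S₂ [ w ]≔ inside)))
      ≡⟨ ∧-factorˡ (not (lookup S₂ w)) (X₁ S₁) (X₂ S₂) (X₂ (S₂ [ w ]≔ inside)) ⟩
    X₁ S₁ ∧ (not (lookup S₂ w) ∧ (X₂ S₂ ∧ X₂ (S₂ [ w ]≔ inside)))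
      ≡⟨ sym (join-++ X₁ (lk X₂ w) S₁ S₂) ⟩
    join X₁ (lk X₂ w) (S₁ ++ᵥ S₂) ∎

  isVertex-join-↑ˡ : X₂ ∅ ≡ true → (v : Fin m) → isVertex (join X₁ X₂) (v ↑ˡ k) ≡ isVertex X₁ v
  isVertex-join-↑ˡ ∅∈X₂ v = trans (cong (join X₁ X₂) (⁅↑ˡ⁆ k v)) (join-++-∅ʳ ∅∈X₂ ⁅ v ⁆)

  isVertex-join-↑ʳ : X₁ ∅ ≡ true → (w : Fin k) → isVertex (join X₁ X₂) (m ↑ʳ w) ≡ isVertex X₂ w
  isVertex-join-↑ʳ ∅∈X₁ w = trans (cong (join X₁ X₂) (⁅↑ʳ⁆ m w)) (join-∅-++ˡ ∅∈X₁ ⁅ w ⁆)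

join-≗ˡ : (A B : Family m) (X₂ : Family k) → X₂ ∅ ≡ true → (join A X₂ ≗ join B X₂ ⇔ A ≗ B)
join-≗ˡ {m} A B X₂ ∅∈X₂ = mk⇔
  (λ A*≗B* S → trans (sym (join-++-∅ʳ A X₂ ∅∈X₂ S)) (trans (A*≗B* (S ++ᵥ ∅)) (join-++-∅ʳ B X₂ ∅∈X₂ S)))
  (λ A≗B S → cong (_∧ X₂ (drop m S)) (A≗B (take m S)))

join-≗ʳ : (X₁ : Family m) (A B : Family k) → X₁ ∅ ≡ true → (join X₁ A ≗ join X₁ B ⇔ A ≗ B)
join-≗ʳ {m} X₁ A B ∅∈X₁ = mk⇔
  (λ *A≗*B S → trans (sym (join-∅-++ˡ X₁ A ∅∈X₁ S)) (trans (*A≗*B (∅ ++ᵥ S)) (join-∅-++ˡ X₁ B ∅∈X₁ S)))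
  (λ A≗B S → cong (X₁ (take m S) ∧_) (A≗B (drop m S)))

isNonConeVertex-join-↑ˡ : (X₁ : Family m) (X₂ : Family k) → X₂ ∅ ≡ true →
                          (v : Fin m) → isNonConeVertex (join X₁ X₂) (v ↑ˡ k) ≡ isNonConeVertex X₁ v
isNonConeVertex-join-↑ˡ X₁ X₂ ∅∈X₂ v = cong₂ _∧_ (isVertex-join-↑ˡ X₁ X₂ ∅∈X₂ v) (cong not
  (trans (sameFamily-cong (lk-join-↑ˡ X₁ X₂ v) (del-join-↑ˡ X₁ X₂ v)) (sameFamily-resp-⇔ (join-≗ˡ (lk X₁ v) (del X₁ v) X₂ ∅∈X₂))))

isNonConeVertex-join-↑ʳ : (X₁ : Family m) (X₂ : Family k) → X₁ ∅ ≡ true →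
                          (w : Fin k) → isNonConeVertex (join X₁ X₂) (m ↑ʳ w) ≡ isNonConeVertex X₂ w
isNonConeVertex-join-↑ʳ X₁ X₂ ∅∈X₁ w = cong₂ _∧_ (isVertex-join-↑ʳ X₁ X₂ ∅∈X₁ w) (cong not
  (trans (sameFamily-cong (lk-join-↑ʳ X₁ X₂ w) (del-join-↑ʳ X₁ X₂ w)) (sameFamily-resp-⇔ (join-≗ʳ X₁ (lk X₂ w) (del X₂ w) ∅∈X₁))))

nonConeVertices-join : (X₁ : Family m) (X₂ : Family k) → X₁ ∅ ≡ true → X₂ ∅ ≡ true →
                       nonConeVertices (join X₁ X₂) ≡ map (_↑ˡ k) (nonConeVertices X₁) ++ map (m ↑ʳ_) (nonConeVertices X₂)
nonConeVertices-join {m} {k} X₁ X₂ ∅∈X₁ ∅∈X₂ = begin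
  filterᵇ p (allFin (m + k))
    ≡⟨ cong (filterᵇ p) (allFin-+ m k) ⟩
  filterᵇ p (map (_↑ˡ k) (allFin m) ++ map (m ↑ʳ_) (allFin k))
    ≡⟨ filter-++ (T? ∘ p) (map (_↑ˡ k) (allFin m)) (map (m ↑ʳ_) (allFin k)) ⟩
  filterᵇ p (map (_↑ˡ k) (allFin m)) ++ filterᵇ p (map (m ↑ʳ_) (allFin k))
    ≡⟨ cong₂ _++_ (filterᵇ-map p (_↑ˡ k) (allFin m)) (filterᵇ-map p (m ↑ʳ_) (allFin k)) ⟩
  map (_↑ˡ k) (filterᵇ (p ∘ (_↑ˡ k)) (allFin m)) ++ map (m ↑ʳ_) (filterᵇ (p ∘ (m ↑ʳ_)) (allFin k))
    ≡⟨ cong₂ (λ l r → map (_↑ˡ k) l ++ map (m ↑ʳ_) r) (filterᵇ-cong (isNonConeVertex-join-↑ˡ X₁ X₂ ∅∈X₂) (allFin m))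
                                                     (filterᵇ-cong (isNonConeVertex-join-↑ʳ X₁ X₂ ∅∈X₁) (allFin k)) ⟩
  map (_↑ˡ k) (nonConeVertices X₁) ++ map (m ↑ʳ_) (nonConeVertices X₂) ∎
  where
  p : Fin (m + k) → Bool
  p = isNonConeVertex (join X₁ X₂)

branch-join-↑ˡ : ∀ F g (X₁ : Family m) (X₂ : Family k) (v : Fin m) {c : ℕ} →
                 θ-fuel F (join (del X₁ v) X₂) ≡ θ-fuel g (del X₁ v) + c →
                 θ-fuel F (join (lk X₁ v) X₂) ≡ θ-fuel g (lk X₁ v) + c →
                 branch F (join X₁ X₂) (v ↑ˡ k) ≡ branch g X₁ v + c
branch-join-↑ˡ {k = k} F g X₁ X₂ v {c} del≡ lk≡ = begin
  θ-fuel F (del (join X₁ X₂) (v ↑ˡ k)) ⊔ suc (θ-fuel F (lk (join X₁ X₂) (v ↑ˡ k)))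
    ≡⟨ cong₂ (λ a b → a ⊔ suc b) (trans (θ-fuel-cong F (del-join-↑ˡ X₁ X₂ v)) del≡)
                                 (trans (θ-fuel-cong F (lk-join-↑ˡ X₁ X₂ v)) lk≡) ⟩
  (θ-fuel g (del X₁ v) + c) ⊔ suc (θ-fuel g (lk X₁ v) + c)
    ≡⟨ sym (+-distribʳ-⊔ c (θ-fuel g (del X₁ v)) (suc (θ-fuel g (lk X₁ v)))) ⟩
  branch g X₁ v + c ∎

branch-join-↑ʳ : ∀ F g (X₁ : Family m) (X₂ : Family k) (w : Fin k) {c : ℕ} →
                 θ-fuel F (join X₁ (del X₂ w)) ≡ c + θ-fuel g (del X₂ w) →
                 θ-fuel F (join X₁ (lk X₂ w)) ≡ c + θ-fuel g (lk X₂ w) →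
                 branch F (join X₁ X₂) (m ↑ʳ w) ≡ c + branch g X₂ w
branch-join-↑ʳ {m} F g X₁ X₂ w {c} del≡ lk≡ = begin
  θ-fuel F (del (join X₁ X₂) (m ↑ʳ w)) ⊔ suc (θ-fuel F (lk (join X₁ X₂) (m ↑ʳ w)))
    ≡⟨ cong₂ (λ a b → a ⊔ suc b) (trans (θ-fuel-cong F (del-join-↑ʳ X₁ X₂ w)) del≡)
                                 (trans (θ-fuel-cong F (lk-join-↑ʳ X₁ X₂ w)) lk≡) ⟩
  (c + θ-fuel g (del X₂ w)) ⊔ suc (c + θ-fuel g (lk X₂ w))
    ≡⟨ cong ((c + θ-fuel g (del X₂ w)) ⊔_) (sym (+-suc c (θ-fuel g (lk X₂ w)))) ⟩
  (c + θ-fuel g (del X₂ w)) ⊔ (c + suc (θ-fuel g (lk X₂ w)))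
    ≡⟨ sym (+-distribˡ-⊔ c (θ-fuel g (del X₂ w)) (suc (θ-fuel g (lk X₂ w)))) ⟩
  c + branch g X₂ w ∎

θ-fuel-join : ∀ F {f₁ f₂} (X₁ : Family m) (X₂ : Family k) → F ≡ f₁ + f₂ →
              X₁ ∅ ≡ true → X₂ ∅ ≡ true → ∣ vertices X₁ ∣ ≤ f₁ → ∣ vertices X₂ ∣ ≤ f₂ →
              θ-fuel F (join X₁ X₂) ≡ θ-fuel f₁ X₁ + θ-fuel f₂ X₂
θ-fuel-join zero {zero}  {zero}  _ _ _  _ _ _ _ = refl
θ-fuel-join zero {zero}  {suc _} _ _ () _ _ _ _
θ-fuel-join zero {suc _}         _ _ () _ _ _ _
θ-fuel-join {m} {k} (suc F) {f₁} {f₂} X₁ X₂ F≡ ∅∈X₁ ∅∈X₂ fuel₁ fuel₂ = begin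
  θ-fuel (suc F) J
    ≡⟨ θ-fuel-suc F J ⟩
  minList (map (branch F J) (nonConeVertices J))
    ≡⟨ cong (minList ∘ map (branch F J)) (nonConeVertices-join X₁ X₂ ∅∈X₁ ∅∈X₂) ⟩
  minList (map (branch F J) (map (_↑ˡ k) (nonConeVertices X₁) ++ map (m ↑ʳ_) (nonConeVertices X₂)))
    ≡⟨ cong minList (map-++ (branch F J) (map (_↑ˡ k) (nonConeVertices X₁)) (map (m ↑ʳ_) (nonConeVertices X₂))) ⟩
  minList (map (branch F J) (map (_↑ˡ k) (nonConeVertices X₁)) ++ map (branch F J) (map (m ↑ʳ_) (nonConeVertices X₂)))
    ≡⟨ cong₂ (λ l r → minList (l ++ r)) (map-map-cong-local {g = branch F J} {g′ = _+ θ₂} branch-↑ˡ) (map-map-cong-local {g = branch F J} {g′ = θ₁ +_} branch-↑ʳ) ⟩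
  minList (map (_+ θ₂) (map (branch (pred f₁) X₁) (nonConeVertices X₁)) ++
           map (θ₁ +_) (map (branch (pred f₂) X₂) (nonConeVertices X₂)))
    ≡⟨ minList-+-++ (map (branch (pred f₁) X₁) (nonConeVertices X₁)) (map (branch (pred f₂) X₂) (nonConeVertices X₂))
                    (θ-fuel-unfold f₁ X₁ fuel₁) (θ-fuel-unfold f₂ X₂ fuel₂) ⟩
  θ₁ + θ₂ ∎
  where
  J : Family (m + k)
  J = join X₁ X₂
  θ₁ θ₂ : ℕ
  θ₁ = θ-fuel f₁ X₁
  θ₂ = θ-fuel f₂ X₂

  branch-↑ˡ : ∀ {v} → v ∈ nonConeVertices X₁ → branch F J (v ↑ˡ k) ≡ branch (pred f₁) X₁ v + θ₂
  branch-↑ˡ {v} v∈ = branch-join-↑ˡ F (pred f₁) X₁ X₂ v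
    (θ-fuel-join F (del X₁ v) X₂ F≡′ (del-∅ X₁ v ∅∈X₁) ∅∈X₂ (p⊂q⇒∣p∣≤pred (del-vertices-⊂ X₁ v vX) fuel₁) fuel₂)
    (θ-fuel-join F (lk X₁ v) X₂ F≡′ (lk-∅ X₁ v ∅∈X₁ vX) ∅∈X₂ (p⊂q⇒∣p∣≤pred (lk-vertices-⊂ X₁ v vX) fuel₁) fuel₂)
    where
    vX : isVertex X₁ v ≡ true
    vX = ∈-nonConeVertices⇒vertex X₁ v∈
    F≡′ : F ≡ pred f₁ + f₂
    F≡′ = suc-injective (trans F≡ (cong (_+ f₂) (nonConeVertex⇒fuel-suc X₁ v∈ fuel₁)))

  branch-↑ʳ : ∀ {w} → w ∈ nonConeVertices X₂ → branch F J (m ↑ʳ w) ≡ θ₁ + branch (pred f₂) X₂ w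
  branch-↑ʳ {w} w∈ = branch-join-↑ʳ F (pred f₂) X₁ X₂ w
    (θ-fuel-join F X₁ (del X₂ w) F≡′ ∅∈X₁ (del-∅ X₂ w ∅∈X₂) fuel₁ (p⊂q⇒∣p∣≤pred (del-vertices-⊂ X₂ w wX) fuel₂))
    (θ-fuel-join F X₁ (lk X₂ w) F≡′ ∅∈X₁ (lk-∅ X₂ w ∅∈X₂ wX) fuel₁ (p⊂q⇒∣p∣≤pred (lk-vertices-⊂ X₂ w wX) fuel₂))
    where
    wX : isVertex X₂ w ≡ true
    wX = ∈-nonConeVertices⇒vertex X₂ w∈
    F≡′ : F ≡ f₁ + pred f₂
    F≡′ = suc-injective (trans F≡ (trans (cong (f₁ +_) (nonConeVertex⇒fuel-suc X₂ w∈ fuel₂)) (+-suc f₁ (pred f₂))))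

theorem11 : (m k : ℕ) (X₁ : Family m) (X₂ : Family k) →
    IsSimplicialComplex X₁ → IsSimplicialComplex X₂ →
    X₁ ∅ ≡ true → X₂ ∅ ≡ true →
    θ (join X₁ X₂) ≡ θ X₁ + θ X₂
theorem11 m k X₁ X₂ _ _ ∅∈X₁ ∅∈X₂ =
  θ-fuel-join (m + k) X₁ X₂ refl ∅∈X₁ ∅∈X₂ (∣p∣≤n (vertices X₁)) (∣p∣≤n (vertices X₂))
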